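{- Let $k\ge 1$ and let $C\subseteq\{0,1,\dots,k-1\}$, interpreted as bit positions of $k$-bit binary numbers in $[0,2^k)$ (position $0$ least significant, position $k-1$ most significant). Then there exists a bijection $f$ on $[0,2^k)$ that permutes the bits of its argument so that the bits in the positions of $C$ are moved to the $|C|$ most significant positions, such that both $f$ and $f^{ -1}$ can be expressed as compositions of $O(|C|k)$ piecewise linear bijections on $[0,2^k)$, each with $O(1)$ pieces.
   Context: A piecewise linear bijection on the integers in a range $[L,R)$ is specified by integer endpoints dividing $[L,R)$ into consecutive intervals (pieces) and, for each piece $I_j$, integer coefficients $a_j,b_j$, such that $x\mapsto a_jx+b_j$ for $x\in I_j$ defines a bijection of the integers in $[L,R)$. -}

module Defs where

open import Data.Nat as ℕ using (ℕ; zero; suc; _/_; _%_; _^_)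
open import Data.Integer as ℤ using (ℤ; +_)
open import Data.Fin using (Fin; zero; suc; toℕ; inject₁; fromℕ)
open import Data.Fin.Permutation using (Permutation′; _⟨$⟩ʳ_)
open import Data.List using (List; []; _∷_; map; allFin)
open import Data.Nat.ListAction using (sum)
open import Data.Product using (Σ; _×_)
open import Relation.Binary.PropositionalEquality using (_≡_)

bit : ℕ → ℕ → ℕ
bit x zero    = x % 2
bit x (suc i) = bit (x / 2) i

bitPerm : (k : ℕ) → Permutation′ k → ℕ → ℕ
bitPerm k σ x = sum (map (λ i → bit x (toℕ i) ℕ.* 2 ^ toℕ (σ ⟨$⟩ʳ i)) (allFin k))

record PLBij (L R : ℤ) : Set where
  field
    pieces    : ℕ
    ends      : Fin (suc pieces) → ℤ
    ends-first : ends zero ≡ L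
    ends-last  : ends (fromℕ pieces) ≡ R
    ends-incr  : (j : Fin pieces) → ends (inject₁ j) ℤ.< ends (suc j)
    a b       : Fin pieces → ℤ
    fun       : ℤ → ℤ
    fun-piece : (j : Fin pieces) (x : ℤ) → ends (inject₁ j) ℤ.≤ x → x ℤ.< ends (suc j) →
                fun x ≡ a j ℤ.* x ℤ.+ b j
    fun-into  : (x : ℤ) → L ℤ.≤ x → x ℤ.< R → (L ℤ.≤ fun x) × (fun x ℤ.< R)
    fun-inj   : (x y : ℤ) → L ℤ.≤ x → x ℤ.< R → L ℤ.≤ y → y ℤ.< R → fun x ≡ fun y → x ≡ y
    fun-surj  : (y : ℤ) → L ℤ.≤ y → y ℤ.< R → Σ ℤ (λ x → (L ℤ.≤ x) × (x ℤ.< R) × (fun x ≡ y))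

-- composition of a list of maps; the head is applied first
compose : {L R : ℤ} → List (PLBij L R) → ℤ → ℤ
compose []       x = x
compose (g ∷ gs) x = compose gs (PLBij.fun g x)

-- Two bit permutations of [0, 2^k) are piecewise linear with few pieces: the cyclic rotation of
-- all bits (x ↦ 2x on the lower half, x ↦ 2x + 1 − 2^k on the upper half) and the exchange of the
-- two most significant bits (on four blocks of length 2^(k−2), the middle two are swapped).
-- Rotating k − 1 − a times and then a times "swap the top two bits, rotate" carries bit a to the
-- top and shifts the bits above it down by one, with at most 2k maps; a word of the same kind
-- undoes it. Moving the positions of C to the top one at a time, from the highest down, gathers C
-- in the |C| most significant positions with at most 2|C|k maps in each direction.

module Submission where

open import Defs
import Algebra.Properties.Semiring.Sum as SemiringSum
open import Data.Bool using (Bool; true; false; if_then_else_)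
open import Data.Fin using (Fin; zero; suc; toℕ; fromℕ<; inject₁)
open import Data.Fin.Properties using (toℕ-fromℕ<; toℕ-injective; toℕ<n; toℕ-inject₁; toℕ-fromℕ)
open import Data.Fin.Permutation using (Permutation′; _⟨$⟩ʳ_; _⟨$⟩ˡ_; inverseˡ; permutation)
open import Data.Fin.Subset using (Subset; _∈_; ∣_∣)
open import Data.Integer as ℤ using (ℤ; +_; +≤+; +<+)
import Data.Integer.Properties as ℤ
import Data.Integer.Tactic.RingSolver as ℤ-Ring
open import Data.List using (List; []; _∷_; _++_; map; replicate; length; tabulate)
open import Data.List.Properties using (map-tabulate; length-++; length-replicate; length-map)
open import Data.List.Relation.Unary.All using (All; universal)
open import Data.List.Relation.Unary.All.Properties using (map⁺)
open import Data.Nat using (ℕ; zero; suc; _+_; _*_; _∸_; _^_; _≤_; _<_; z≤n; s≤s; z<s; NonZero; _≟_; _<?_; _≤?_)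
open import Data.Nat.Divisibility using (divides-refl)
open import Data.Nat.DivMod
  using (_/_; _%_; m%n<n; m≡m%n+[m/n]*n; m*n/n≡m; m<n*o⇒m/o<n; [m+kn]%n≡m%n; m<n⇒m%n≡m; m<n⇒m/n≡0; +-distrib-/-∣ʳ)
open import Data.Nat.ListAction using (sum)
open import Data.Nat.Properties
open import Data.Nat.Tactic.RingSolver using (solve-∀)
open import Data.Product using (Σ; _×_; _,_; proj₁; proj₂)
open import Data.Sum using (inj₁; inj₂)
open import Data.Vec using ([]; _∷_; lookup)
open import Data.Vec.Properties using ([]=⇒lookup; lookup⇒[]=)
open import Function using (_∘_; _∘′_; id)
open import Function.Bundles using (_⇔_; mk⇔)
open import Function.Properties.Equivalence using (⇔-setoid)
open import Level using (0ℓ)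
open import Relation.Binary.PropositionalEquality
import Relation.Binary.Reasoning.Setoid as ≈-Reasoning
open import Relation.Nullary using (yes; no)
open import Relation.Nullary.Negation using (contradiction)

[m+kn]%n≡m : ∀ {m n} k .{{_ : NonZero n}} → m < n → (m + k * n) % n ≡ m
[m+kn]%n≡m {m} {n} k m<n = trans ([m+kn]%n≡m%n m k n) (m<n⇒m%n≡m m<n)

[m+kn]/n≡k : ∀ {m n} k .{{_ : NonZero n}} → m < n → (m + k * n) / n ≡ k
[m+kn]/n≡k {m} {n} k m<n = begin
  (m + k * n) / n   ≡⟨ +-distrib-/-∣ʳ m (divides-refl k) ⟩
  m / n + k * n / n ≡⟨ cong₂ _+_ (m<n⇒m/n≡0 m<n) (m*n/n≡m k n) ⟩
  k                 ∎
  where open ≡-Reasoning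

m+1+n<1+o⇒m+n<o : ∀ {m n o} → m + suc n < suc o → m + n < o
m+1+n<1+o⇒m+n<o {m} {n} {o} = ≤-pred ∘ subst (_< suc o) (+-suc m n)

1+o≤m+1+n⇒o≤m+n : ∀ {m n o} → suc o ≤ m + suc n → o ≤ m + n
1+o≤m+1+n⇒o≤m+n {m} {n} {o} = ≤-pred ∘ subst (suc o ≤_) (+-suc m n)

m+n≡o∧n<o⇒0<m : ∀ {m n o} → m + n ≡ o → n < o → 0 < m
m+n≡o∧n<o⇒0<m {zero}  refl n<n = contradiction n<n (n≮n _)
m+n≡o∧n<o⇒0<m {suc m} _    _   = z<s

≤+⇔∸≤ : ∀ {k m j} → (k ≤ j + m) ⇔ (k ∸ m ≤ j)
≤+⇔∸≤ {k} {m} {j} = mk⇔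
  (λ k≤j+m → m≤n+o⇒m∸n≤o k m (subst (k ≤_) (+-comm j m) k≤j+m))
  (λ k∸m≤j → subst (k ≤_) (+-comm m j) (≤-trans (m≤n+m∸n k m) (+-monoʳ-≤ m k∸m≤j)))

Bits : (ℕ → ℕ) → Set
Bits d = ∀ j → d j ≤ 1

fromBits : ℕ → (ℕ → ℕ) → ℕ
fromBits zero    d = 0
fromBits (suc k) d = d 0 + fromBits k (d ∘ suc) * 2

fromBits-cong : ∀ k {d e : ℕ → ℕ} → (∀ {j} → j < k → d j ≡ e j) → fromBits k d ≡ fromBits k e
fromBits-cong zero    eq = refl
fromBits-cong (suc k) eq = cong₂ (λ b x → b + x * 2) (eq (s≤s z≤n)) (fromBits-cong k (eq ∘ s≤s))

fromBits-< : ∀ k {d} → Bits d → fromBits k d < 2 ^ k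
fromBits-< zero    bits = s≤s z≤n
fromBits-< (suc k) {d} bits = begin
  suc (d 0 + fromBits k (d ∘ suc) * 2) ≤⟨ s≤s (+-monoˡ-≤ _ (bits 0)) ⟩
  2 + fromBits k (d ∘ suc) * 2         ≡⟨⟩
  suc (fromBits k (d ∘ suc)) * 2       ≤⟨ *-monoˡ-≤ 2 (fromBits-< k (bits ∘ suc)) ⟩
  2 ^ k * 2                            ≡⟨ *-comm (2 ^ k) 2 ⟩
  2 ^ suc k                            ∎
  where open ≤-Reasoning

bits-bit : ∀ x → Bits (bit x)
bits-bit x zero    = ≤-pred (m%n<n x 2)
bits-bit x (suc j) = bits-bit (x / 2) j

bit-fromBits : ∀ k {d} → Bits d → ∀ {j} → j < k → bit (fromBits k d) j ≡ d j
bit-fromBits (suc k) {d} bits {zero}  _         = [m+kn]%n≡m (fromBits k (d ∘ suc)) (s≤s (bits 0))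
bit-fromBits (suc k) {d} bits {suc j} (s≤s j<k) = begin
  bit ((d 0 + fromBits k (d ∘ suc) * 2) / 2) j ≡⟨ cong (λ x → bit x j) ([m+kn]/n≡k _ (s≤s (bits 0))) ⟩
  bit (fromBits k (d ∘ suc)) j                 ≡⟨ bit-fromBits k (bits ∘ suc) j<k ⟩
  d (suc j)                                    ∎
  where open ≡-Reasoning

fromBits-bit : ∀ k {x} → x < 2 ^ k → fromBits k (bit x) ≡ x
fromBits-bit zero    {zero}  _          = refl
fromBits-bit zero    {suc x} (s≤s ())
fromBits-bit (suc k) {x} x<2^k+1 = begin
  x % 2 + fromBits k (bit (x / 2)) * 2 ≡⟨ cong (λ y → x % 2 + y * 2) (fromBits-bit k x/2<2^k) ⟩
  x % 2 + x / 2 * 2                    ≡⟨ m≡m%n+[m/n]*n x 2 ⟨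
  x                                    ∎
  where
  open ≡-Reasoning
  x/2<2^k : x / 2 < 2 ^ k
  x/2<2^k = m<n*o⇒m/o<n (subst (x <_) (*-comm 2 (2 ^ k)) x<2^k+1)

bit-injective : ∀ k {x y} → x < 2 ^ k → y < 2 ^ k → (∀ {j} → j < k → bit x j ≡ bit y j) → x ≡ y
bit-injective k {x} {y} x< y< eq = begin
  x                  ≡⟨ fromBits-bit k x< ⟨
  fromBits k (bit x) ≡⟨ fromBits-cong k eq ⟩
  fromBits k (bit y) ≡⟨ fromBits-bit k y< ⟩
  y                  ∎
  where open ≡-Reasoning

fromBits-suc : ∀ n d → fromBits (suc n) d ≡ fromBits n d + d n * 2 ^ n
fromBits-suc zero    d = trans (+-identityʳ (d 0)) (sym (*-identityʳ (d 0)))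
fromBits-suc (suc n) d = begin
  d 0 + fromBits (suc n) (d ∘ suc) * 2                     ≡⟨ cong (λ x → d 0 + x * 2) (fromBits-suc n (d ∘ suc)) ⟩
  d 0 + (fromBits n (d ∘ suc) + d (suc n) * 2 ^ n) * 2     ≡⟨ regroup (d 0) (fromBits n (d ∘ suc)) (d (suc n)) (2 ^ n) ⟩
  d 0 + fromBits n (d ∘ suc) * 2 + d (suc n) * (2 * 2 ^ n) ∎
  where
  open ≡-Reasoning
  regroup : ∀ b x c p → b + (x + c * p) * 2 ≡ b + x * 2 + c * (2 * p)
  regroup = solve-∀

module VecSum = SemiringSum +-*-semiring

sum-tabulate : ∀ n (f : Fin n → ℕ) → sum (tabulate f) ≡ VecSum.sum f
sum-tabulate zero    f = refl
sum-tabulate (suc n) f = cong (_+_ (f zero)) (sum-tabulate n (f ∘ suc))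

fromBits-sum : ∀ n d → fromBits n d ≡ VecSum.sum (λ (i : Fin n) → d (toℕ i) * 2 ^ toℕ i)
fromBits-sum zero    d = refl
fromBits-sum (suc n) d = cong₂ _+_ (sym (*-identityʳ (d 0))) (begin
  fromBits n (d ∘ suc) * 2                                 ≡⟨ cong (_* 2) (fromBits-sum n (d ∘ suc)) ⟩
  VecSum.sum {n} (λ i → d (suc (toℕ i)) * 2 ^ toℕ i) * 2   ≡⟨ VecSum.*-distribʳ-sum {n} 2 _ ⟩
  VecSum.sum {n} (λ i → d (suc (toℕ i)) * 2 ^ toℕ i * 2)   ≡⟨ VecSum.sum-cong-≗ {n} (λ i → reassoc (d (suc (toℕ i))) _) ⟩
  VecSum.sum {n} (λ i → d (suc (toℕ i)) * (2 * 2 ^ toℕ i)) ∎)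
  where
  open ≡-Reasoning
  reassoc : ∀ b p → b * p * 2 ≡ b * (2 * p)
  reassoc b p = trans (*-assoc b p 2) (cong (b *_) (*-comm p 2))

bitPerm-fromBits : ∀ k (σ : Permutation′ k) (P : ℕ → ℕ) → (∀ i → toℕ (σ ⟨$⟩ˡ i) ≡ P (toℕ i)) →
                   ∀ x → bitPerm k σ x ≡ fromBits k (bit x ∘ P)
bitPerm-fromBits k σ P σ⁻¹≗P x = begin
  bitPerm k σ x                                        ≡⟨ cong sum (map-tabulate id term) ⟩
  sum (tabulate term)                                  ≡⟨ sum-tabulate k term ⟩
  VecSum.sum {k} term                                  ≡⟨ VecSum.sum-cong-≗ {k} (λ i → cong (λ j → bit x (toℕ j) * _) (inverseˡ σ)) ⟨
  VecSum.sum {k} (λ i → term′ (σ ⟨$⟩ʳ i))              ≡⟨ VecSum.sum-permute term′ σ ⟨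
  VecSum.sum {k} term′                                 ≡⟨ VecSum.sum-cong-≗ {k} (λ i → cong (λ j → bit x j * 2 ^ toℕ i) (σ⁻¹≗P i)) ⟩
  VecSum.sum {k} (λ i → bit x (P (toℕ i)) * 2 ^ toℕ i) ≡⟨ fromBits-sum k (bit x ∘ P) ⟨
  fromBits k (bit x ∘ P)                               ∎
  where
  open ≡-Reasoning
  term term′ : Fin k → ℕ
  term  i = bit x (toℕ i) * 2 ^ toℕ (σ ⟨$⟩ʳ i)
  term′ i = bit x (toℕ (σ ⟨$⟩ˡ i)) * 2 ^ toℕ i

record Inverses (k : ℕ) (f g : ℕ → ℕ) : Set where
  field
    f-< : ∀ {j} → j < k → f j < k
    g-< : ∀ {j} → j < k → g j < k
    f∘g : ∀ {j} → j < k → f (g j) ≡ j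
    g∘f : ∀ {j} → j < k → g (f j) ≡ j

Inverses-id : ∀ {k} → Inverses k id id
Inverses-id = record { f-< = id ; g-< = id ; f∘g = λ _ → refl ; g∘f = λ _ → refl }

Inverses-∘ : ∀ {k f g f′ g′} → Inverses k f g → Inverses k f′ g′ → Inverses k (f ∘ f′) (g′ ∘ g)
Inverses-∘ {f = f} {g} {f′} {g′} I I′ = record
  { f-< = I.f-< ∘ I′.f-<
  ; g-< = I′.g-< ∘ I.g-<
  ; f∘g = λ j< → trans (cong f (I′.f∘g (I.g-< j<))) (I.f∘g j<)
  ; g∘f = λ j< → trans (cong g′ (I.g∘f (I′.f-< j<))) (I′.g∘f j<)
  }
  where
  module I  = Inverses I
  module I′ = Inverses I′

Inverses-cong : ∀ {k f g f′ g′} → (∀ j → f j ≡ f′ j) → (∀ j → g j ≡ g′ j) →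
                Inverses k f g → Inverses k f′ g′
Inverses-cong {f = f} {g} {f′} {g′} f≗f′ g≗g′ I = record
  { f-< = λ {j} j< → subst (_< _) (f≗f′ j) (f-< j<)
  ; g-< = λ {j} j< → subst (_< _) (g≗g′ j) (g-< j<)
  ; f∘g = λ {j} j< → trans (sym (trans (cong f (g≗g′ j)) (f≗f′ (g′ j)))) (f∘g j<)
  ; g∘f = λ {j} j< → trans (sym (trans (cong g (f≗f′ j)) (g≗g′ (f′ j)))) (g∘f j<)
  }
  where open Inverses I

module _ {k f g} (I : Inverses k f g) where
  open Inverses I

  toPermutation : Permutation′ k
  toPermutation = permutation (lift g g-<) (lift f f-<)
    (λ i → toℕ-injective (lift-∘ f-< g-< g∘f i))
    (λ i → toℕ-injective (lift-∘ g-< f-< f∘g i))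
    where
    lift : (h : ℕ → ℕ) → (∀ {j} → j < k → h j < k) → Fin k → Fin k
    lift h h-< i = fromℕ< (h-< (toℕ<n i))
    lift-∘ : ∀ {h h′} (h-< : ∀ {j} → j < k → h j < k) (h′-< : ∀ {j} → j < k → h′ j < k) →
             (∀ {j} → j < k → h′ (h j) ≡ j) → ∀ i → toℕ (lift h′ h′-< (lift h h-< i)) ≡ toℕ i
    lift-∘ {h} {h′} h-< h′-< h′∘h i =
      trans (toℕ-fromℕ< _) (trans (cong h′ (toℕ-fromℕ< _)) (h′∘h (toℕ<n i)))

  toPermutation-ʳ : ∀ i → toℕ (toPermutation ⟨$⟩ʳ i) ≡ g (toℕ i)
  toPermutation-ʳ i = toℕ-fromℕ< _

  toPermutation-ˡ : ∀ i → toℕ (toPermutation ⟨$⟩ˡ i) ≡ f (toℕ i)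
  toPermutation-ˡ i = toℕ-fromℕ< _

record BitPermuting (k : ℕ) (g : ℕ → ℕ) : Set where
  field
    index index⁻¹ : ℕ → ℕ
    inverses      : Inverses k index index⁻¹
    permutes      : ∀ {d} → Bits d → g (fromBits k d) ≡ fromBits k (d ∘ index)

  open Inverses inverses

  permutes-bit : ∀ {x} → x < 2 ^ k → g x ≡ fromBits k (bit x ∘ index)
  permutes-bit {x} x< = trans (cong g (sym (fromBits-bit k x<))) (permutes (bits-bit x))

  <-preserving : ∀ {x} → x < 2 ^ k → g x < 2 ^ k
  <-preserving {x} x< = subst (_< 2 ^ k) (sym (permutes-bit x<)) (fromBits-< k (bits-bit x ∘ index))

  bit-permutes : ∀ {x} → x < 2 ^ k → ∀ {j} → j < k → bit (g x) j ≡ bit x (index j)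
  bit-permutes {x} x< {j} j< = trans (cong (λ y → bit y j) (permutes-bit x<)) (bit-fromBits k (bits-bit x ∘ index) j<)

  injective : ∀ {x y} → x < 2 ^ k → y < 2 ^ k → g x ≡ g y → x ≡ y
  injective {x} {y} x< y< gx≡gy = bit-injective k x< y< λ {j} j< → begin
    bit x j                  ≡⟨ cong (bit x) (f∘g j<) ⟨
    bit x (index (index⁻¹ j)) ≡⟨ bit-permutes x< (g-< j<) ⟨
    bit (g x) (index⁻¹ j)    ≡⟨ cong (λ z → bit z (index⁻¹ j)) gx≡gy ⟩
    bit (g y) (index⁻¹ j)    ≡⟨ bit-permutes y< (g-< j<) ⟩
    bit y (index (index⁻¹ j)) ≡⟨ cong (bit y) (f∘g j<) ⟩
    bit y j                  ∎
    where open ≡-Reasoning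

  preimage : ℕ → ℕ
  preimage y = fromBits k (bit y ∘ index⁻¹)

  preimage-< : ∀ y → preimage y < 2 ^ k
  preimage-< y = fromBits-< k (bits-bit y ∘ index⁻¹)

  surjective : ∀ {y} → y < 2 ^ k → g (preimage y) ≡ y
  surjective {y} y< = begin
    g (preimage y)                        ≡⟨ permutes (bits-bit y ∘ index⁻¹) ⟩
    fromBits k (bit y ∘ index⁻¹ ∘ index)  ≡⟨ fromBits-cong k (cong (bit y) ∘ g∘f) ⟩
    fromBits k (bit y)                    ≡⟨ fromBits-bit k y< ⟩
    y                                     ∎
    where open ≡-Reasoning

blockMap : (M : ℕ) .{{_ : NonZero M}} → ℕ → (ℕ → ℕ) → ℕ → ℕ
blockMap M α β x = α * (x % M) + β (x / M)

blockMap-block : ∀ {M} .{{_ : NonZero M}} α β {X} v → X < M → blockMap M α β (X + v * M) ≡ α * X + β v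
blockMap-block α β v X<M = cong₂ (λ r q → α * r + β q) ([m+kn]%n≡m v X<M) ([m+kn]/n≡k v X<M)

blockMap-piece : ∀ {M} .{{_ : NonZero M}} α β v {x} → v * M ≤ x → x < suc v * M →
                 + blockMap M α β x ≡ + α ℤ.* + x ℤ.+ (+ β v ℤ.- + α ℤ.* + (v * M))
blockMap-piece {M} α β v {x} vM≤x x<[1+v]M = begin
  + blockMap M α β x                ≡⟨ cong (+_ ∘ blockMap M α β) X+vM≡x ⟨
  + blockMap M α β (X + v * M)      ≡⟨ cong +_ (blockMap-block α β v X<M) ⟩
  + (α * X + β v)                   ≡⟨ trans (ℤ.pos-+ (α * X) (β v)) (cong (ℤ._+ + β v) (ℤ.pos-* α X)) ⟩
  + α ℤ.* + X ℤ.+ + β v             ≡⟨ shift (+ α) (+ X) (+ (v * M)) (+ β v) ⟩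
  + α ℤ.* (+ X ℤ.+ + (v * M)) ℤ.+ c ≡⟨ cong (λ y → + α ℤ.* y ℤ.+ c) (trans (sym (ℤ.pos-+ X (v * M))) (cong +_ X+vM≡x)) ⟩
  + α ℤ.* + x ℤ.+ c                 ∎
  where
  open ≡-Reasoning
  c = + β v ℤ.- + α ℤ.* + (v * M)
  X = x ∸ v * M
  X+vM≡x : X + v * M ≡ x
  X+vM≡x = m∸n+n≡m vM≤x
  X<M : X < M
  X<M = +-cancelʳ-< (v * M) X M (subst (_< M + v * M) (sym X+vM≡x) x<[1+v]M)
  shift : ∀ a X V B → a ℤ.* X ℤ.+ B ≡ a ℤ.* (X ℤ.+ V) ℤ.+ (B ℤ.- a ℤ.* V)
  shift = ℤ-Ring.solve-∀

blockPL : ∀ {k} p M .{{_ : NonZero M}} α β → p * M ≡ 2 ^ k →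
          BitPermuting k (blockMap M α β) → PLBij (+ 0) (+ (2 ^ k))
blockPL {k} p M α β pM≡2^k g = record
  { pieces     = p
  ; ends       = λ j → + (toℕ j * M)
  ; ends-first = refl
  ; ends-last  = trans (cong (λ v → + (v * M)) (toℕ-fromℕ p)) (cong +_ pM≡2^k)
  ; ends-incr  = λ j → +<+ (subst (λ v → v * M < suc (toℕ j) * M) (sym (toℕ-inject₁ j))
                                  (*-monoˡ-< M (n<1+n (toℕ j))))
  ; a          = λ _ → + α
  ; b          = λ v → + β (toℕ v) ℤ.- + α ℤ.* + (toℕ v * M)
  ; fun        = fun
  ; fun-piece  = piece
  ; fun-into   = into
  ; fun-inj    = inj
  ; fun-surj   = surj
  }
  where
  open BitPermuting g
  fun : ℤ → ℤ
  fun x = + blockMap M α β ℤ.∣ x ∣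
  piece : ∀ j x → + (toℕ (inject₁ j) * M) ℤ.≤ x → x ℤ.< + (suc (toℕ j) * M) →
          fun x ≡ + α ℤ.* x ℤ.+ (+ β (toℕ j) ℤ.- + α ℤ.* + (toℕ j * M))
  piece j (+ x) (+≤+ l) (+<+ u) = blockMap-piece α β (toℕ j) (subst (λ v → v * M ≤ x) (toℕ-inject₁ j) l) u
  into : ∀ x → + 0 ℤ.≤ x → x ℤ.< + (2 ^ k) → (+ 0 ℤ.≤ fun x) × (fun x ℤ.< + (2 ^ k))
  into (+ x) _ (+<+ x<) = +≤+ z≤n , +<+ (<-preserving x<)
  inj : ∀ x y → + 0 ℤ.≤ x → x ℤ.< + (2 ^ k) → + 0 ℤ.≤ y → y ℤ.< + (2 ^ k) → fun x ≡ fun y → x ≡ y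
  inj (+ x) (+ y) _ (+<+ x<) _ (+<+ y<) eq = cong +_ (injective x< y< (ℤ.+-injective eq))
  surj : ∀ y → + 0 ℤ.≤ y → y ℤ.< + (2 ^ k) →
         Σ ℤ (λ x → (+ 0 ℤ.≤ x) × (x ℤ.< + (2 ^ k)) × (fun x ≡ y))
  surj (+ y) _ (+<+ y<) = + preimage y , +≤+ z≤n , +<+ (preimage-< y) , cong +_ (surjective y<)

rotateIndex : ℕ → ℕ → ℕ
rotateIndex n zero    = n
rotateIndex n (suc j) = j

rotateIndex⁻¹ : ℕ → ℕ → ℕ
rotateIndex⁻¹ n j with j ≟ n
... | yes _ = zero
... | no  _ = suc j

rotateIndex-inverses : ∀ n → Inverses (suc n) (rotateIndex n) (rotateIndex⁻¹ n)
rotateIndex-inverses n = record { f-< = f-< ; g-< = g-< ; f∘g = f∘g ; g∘f = g∘f }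
  where
  f-< : ∀ {j} → j < suc n → rotateIndex n j < suc n
  f-< {zero}  _         = n<1+n n
  f-< {suc j} (s≤s j<n) = m<n⇒m<1+n j<n
  g-< : ∀ {j} → j < suc n → rotateIndex⁻¹ n j < suc n
  g-< {j} j≤n with j ≟ n
  ... | yes _   = z<s
  ... | no  j≢n = s≤s (≤∧≢⇒< (≤-pred j≤n) j≢n)
  f∘g : ∀ {j} → j < suc n → rotateIndex n (rotateIndex⁻¹ n j) ≡ j
  f∘g {j} _ with j ≟ n
  ... | yes j≡n = sym j≡n
  ... | no  _   = refl
  g∘f : ∀ {j} → j < suc n → rotateIndex⁻¹ n (rotateIndex n j) ≡ j
  g∘f {zero} _ with n ≟ n
  ... | yes _   = refl
  ... | no  n≢n = contradiction refl n≢n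
  g∘f {suc j} (s≤s j<n) with j ≟ n
  ... | yes j≡n = contradiction j≡n (<⇒≢ j<n)
  ... | no  _   = refl

module _ (n : ℕ) where
  private instance
    2^n≢0 : NonZero (2 ^ n)
    2^n≢0 = m^n≢0 2 n

  rotate : ℕ → ℕ
  rotate = blockMap (2 ^ n) 2 id

  rotate-bitPermuting : BitPermuting (suc n) rotate
  rotate-bitPermuting = record
    { index    = rotateIndex n
    ; index⁻¹  = rotateIndex⁻¹ n
    ; inverses = rotateIndex-inverses n
    ; permutes = permutes
    }
    where
    permutes : ∀ {d} → Bits d → rotate (fromBits (suc n) d) ≡ fromBits (suc n) (d ∘ rotateIndex n)
    permutes {d} bits = begin
      rotate (fromBits (suc n) d)         ≡⟨ cong rotate (fromBits-suc n d) ⟩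
      rotate (fromBits n d + d n * 2 ^ n) ≡⟨ blockMap-block 2 id (d n) (fromBits-< n bits) ⟩
      2 * fromBits n d + d n              ≡⟨ +-comm (2 * fromBits n d) (d n) ⟩
      d n + 2 * fromBits n d              ≡⟨ cong (_+_ (d n)) (*-comm 2 (fromBits n d)) ⟩
      d n + fromBits n d * 2              ∎
      where open ≡-Reasoning

swapIndex : ℕ → ℕ → ℕ
swapIndex zero    zero          = 1
swapIndex zero    (suc zero)    = 0
swapIndex zero    (suc (suc j)) = suc (suc j)
swapIndex (suc n) zero          = zero
swapIndex (suc n) (suc j)       = suc (swapIndex n j)

swapIndex-involutive : ∀ n j → swapIndex n (swapIndex n j) ≡ j
swapIndex-involutive zero    zero          = refl
swapIndex-involutive zero    (suc zero)    = refl
swapIndex-involutive zero    (suc (suc j)) = refl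
swapIndex-involutive (suc n) zero          = refl
swapIndex-involutive (suc n) (suc j)       = cong suc (swapIndex-involutive n j)

swapIndex-< : ∀ n {j} → j < suc (suc n) → swapIndex n j < suc (suc n)
swapIndex-< zero    {zero}          _         = s≤s (s≤s z≤n)
swapIndex-< zero    {suc zero}      _         = s≤s z≤n
swapIndex-< zero    {suc (suc j)}   j<        = j<
swapIndex-< (suc n) {zero}          _         = s≤s z≤n
swapIndex-< (suc n) {suc j}         (s≤s j<)  = s≤s (swapIndex-< n j<)

swapIndex-below : ∀ n {j} → j < n → swapIndex n j ≡ j
swapIndex-below (suc n) {zero}  _         = refl
swapIndex-below (suc n) {suc j} (s≤s j<n) = cong suc (swapIndex-below n j<n)

swapIndex-n : ∀ n → swapIndex n n ≡ suc n
swapIndex-n zero    = refl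
swapIndex-n (suc n) = cong suc (swapIndex-n n)

swapIndex-suc-n : ∀ n → swapIndex n (suc n) ≡ n
swapIndex-suc-n zero    = refl
swapIndex-suc-n (suc n) = cong suc (swapIndex-suc-n n)

swapIndex-inverses : ∀ n → Inverses (suc (suc n)) (swapIndex n) (swapIndex n)
swapIndex-inverses n = record
  { f-< = swapIndex-< n ; g-< = swapIndex-< n
  ; f∘g = λ {j} _ → swapIndex-involutive n j ; g∘f = λ {j} _ → swapIndex-involutive n j }

swap₂ : ℕ → ℕ
swap₂ 1 = 2
swap₂ 2 = 1
swap₂ v = v

swap₂-bits : ∀ {b c} → b ≤ 1 → c ≤ 1 → swap₂ (b + c * 2) ≡ c + b * 2
swap₂-bits z≤n       z≤n       = refl
swap₂-bits z≤n       (s≤s z≤n) = refl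
swap₂-bits (s≤s z≤n) z≤n       = refl
swap₂-bits (s≤s z≤n) (s≤s z≤n) = refl

fromBits-top₂ : ∀ n d → fromBits (suc (suc n)) d ≡ fromBits n d + (d n + d (suc n) * 2) * 2 ^ n
fromBits-top₂ n d = begin
  fromBits (suc (suc n)) d                                  ≡⟨ fromBits-suc (suc n) d ⟩
  fromBits (suc n) d + d (suc n) * 2 ^ suc n                ≡⟨ cong (_+ d (suc n) * 2 ^ suc n) (fromBits-suc n d) ⟩
  fromBits n d + d n * 2 ^ n + d (suc n) * (2 * 2 ^ n)      ≡⟨ regroup (fromBits n d) (d n) (d (suc n)) (2 ^ n) ⟩
  fromBits n d + (d n + d (suc n) * 2) * 2 ^ n              ∎
  where
  open ≡-Reasoning
  regroup : ∀ x b c p → x + b * p + c * (2 * p) ≡ x + (b + c * 2) * p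
  regroup = solve-∀

swapBlock : ℕ → ℕ → ℕ
swapBlock n v = swap₂ v * 2 ^ n

module _ (n : ℕ) where
  private instance
    2^n≢0 : NonZero (2 ^ n)
    2^n≢0 = m^n≢0 2 n

  swapTop : ℕ → ℕ
  swapTop = blockMap (2 ^ n) 1 (swapBlock n)

  swapTop-bitPermuting : BitPermuting (suc (suc n)) swapTop
  swapTop-bitPermuting = record
    { index    = swapIndex n
    ; index⁻¹  = swapIndex n
    ; inverses = swapIndex-inverses n
    ; permutes = permutes
    }
    where
    permutes : ∀ {d} → Bits d → swapTop (fromBits (suc (suc n)) d) ≡ fromBits (suc (suc n)) (d ∘ swapIndex n)
    permutes {d} bits = begin
      swapTop (fromBits (suc (suc n)) d)           ≡⟨ cong swapTop (fromBits-top₂ n d) ⟩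
      swapTop (fromBits n d + top d * 2 ^ n)       ≡⟨ blockMap-block 1 (swapBlock n) (top d) (fromBits-< n bits) ⟩
      1 * fromBits n d + swap₂ (top d) * 2 ^ n     ≡⟨ cong₂ (λ x v → x + v * 2 ^ n) (*-identityˡ _) swapped-bits ⟩
      fromBits n d + (d (suc n) + d n * 2) * 2 ^ n ≡⟨ cong₂ (λ x v → x + v * 2 ^ n) fixes-below swapped ⟨
      fromBits n e + top e * 2 ^ n                 ≡⟨ fromBits-top₂ n e ⟨
      fromBits (suc (suc n)) e                     ∎
      where
      open ≡-Reasoning
      top : (ℕ → ℕ) → ℕ
      top d = d n + d (suc n) * 2
      swapped-bits : swap₂ (top d) ≡ d (suc n) + d n * 2
      swapped-bits = swap₂-bits (bits n) (bits (suc n))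
      e = d ∘ swapIndex n
      fixes-below : fromBits n e ≡ fromBits n d
      fixes-below = fromBits-cong n (cong d ∘ swapIndex-below n)
      swapped : e n + e (suc n) * 2 ≡ d (suc n) + d n * 2
      swapped = cong₂ (λ b c → d b + d c * 2) (swapIndex-n n) (swapIndex-suc-n n)

data Op : Set where
  rot swp : Op

opIndex : ℕ → Op → ℕ → ℕ
opIndex n       rot = rotateIndex n
opIndex zero    swp = rotateIndex zero   -- one bit cannot be swapped; rotating it is the identity
opIndex (suc n) swp = swapIndex n

opPL : ∀ n → Op → PLBij (+ 0) (+ (2 ^ suc n))
opPL n       rot = blockPL 2 (2 ^ n) {{m^n≢0 2 n}} 2 id refl (rotate-bitPermuting n)
opPL zero    swp = opPL zero rot
opPL (suc n) swp = blockPL 4 (2 ^ n) {{m^n≢0 2 n}} 1 (swapBlock n) (*-assoc 2 2 (2 ^ n)) (swapTop-bitPermuting n)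

opPL-pieces : ∀ n o → PLBij.pieces (opPL n o) ≤ 4
opPL-pieces n       rot = s≤s (s≤s z≤n)
opPL-pieces zero    swp = s≤s (s≤s z≤n)
opPL-pieces (suc n) swp = ≤-refl

opPL-fromBits : ∀ n o {d} → Bits d →
                PLBij.fun (opPL n o) (+ fromBits (suc n) d) ≡ + fromBits (suc n) (d ∘ opIndex n o)
opPL-fromBits n       rot bits = cong +_ (BitPermuting.permutes (rotate-bitPermuting n) bits)
opPL-fromBits zero    swp bits = opPL-fromBits zero rot bits
opPL-fromBits (suc n) swp bits = cong +_ (BitPermuting.permutes (swapTop-bitPermuting n) bits)

indexMap : ℕ → List Op → ℕ → ℕ
indexMap n []       = id
indexMap n (o ∷ os) = opIndex n o ∘ indexMap n os

indexMap-++ : ∀ n xs ys j → indexMap n (xs ++ ys) j ≡ indexMap n xs (indexMap n ys j)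
indexMap-++ n []       ys j = refl
indexMap-++ n (o ∷ xs) ys j = cong (opIndex n o) (indexMap-++ n xs ys j)

compose-opPL : ∀ n os {d} → Bits d →
               compose (map (opPL n) os) (+ fromBits (suc n) d) ≡ + fromBits (suc n) (d ∘ indexMap n os)
compose-opPL n []       bits = refl
compose-opPL n (o ∷ os) bits = trans (cong (compose (map (opPL n) os)) (opPL-fromBits n o bits))
                                     (compose-opPL n os (bits ∘ opIndex n o))

All-opPL-pieces : ∀ n os → All (λ g → PLBij.pieces g ≤ 4) (map (opPL n) os)
All-opPL-pieces n os = map⁺ (universal (opPL-pieces n) os)

indexMap-inverses-++ : ∀ n xs ys xs′ ys′ → Inverses (suc n) (indexMap n xs) (indexMap n ys) →
                       Inverses (suc n) (indexMap n xs′) (indexMap n ys′) →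
                       Inverses (suc n) (indexMap n (xs ++ xs′)) (indexMap n (ys′ ++ ys))
indexMap-inverses-++ n xs ys xs′ ys′ I I′ =
  Inverses-cong (sym ∘ indexMap-++ n xs xs′) (sym ∘ indexMap-++ n ys′ ys) (Inverses-∘ I I′)

rotateAll : ℕ → List Op
rotateAll r = replicate r rot

rotateLower : ℕ → List Op
rotateLower zero    = []
rotateLower (suc b) = swp ∷ rot ∷ rotateLower b

swp-below : ∀ n {t} → suc t < n → opIndex n swp t ≡ t
swp-below (suc n) (s≤s t<n) = swapIndex-below n t<n

length-rotateLower : ∀ b → length (rotateLower b) ≡ b * 2
length-rotateLower zero    = refl
length-rotateLower (suc b) = cong (λ l → suc (suc l)) (length-rotateLower b)

rotateIndex-+suc : ∀ n {p} r → 0 < p → rotateIndex n p + suc r ≡ p + r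
rotateIndex-+suc n {suc p} r _ = +-suc p r

swp-rot-+suc : ∀ n {p} b → 0 < p → p < n → opIndex n swp (rotateIndex n p) + suc b ≡ p + b
swp-rot-+suc n {suc p} b _ p<n = trans (cong (_+ suc b) (swp-below n p<n)) (+-suc p b)

swp-rot-top : ∀ n → opIndex n swp (rotateIndex n n) ≡ n
swp-rot-top zero    = refl
swp-rot-top (suc n) = swapIndex-n n

swp-rot-zero : ∀ n b → 0 < n → opIndex n swp (rotateIndex n 0) + suc b ≡ b + n
swp-rot-zero (suc n) b _ = begin
  swapIndex n (suc n) + suc b ≡⟨ cong (_+ suc b) (swapIndex-suc-n n) ⟩
  n + suc b                   ≡⟨ +-comm n (suc b) ⟩
  suc b + n                   ≡⟨ +-suc b n ⟨
  b + suc n                   ∎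
  where open ≡-Reasoning

module _ (n : ℕ) where

  rotateAll-shift : ∀ r t → t + r ≤ n → indexMap n (rotateAll r) (t + r) ≡ t
  rotateAll-shift zero    t _     = +-identityʳ t
  rotateAll-shift (suc r) t t+r≤n = cong (rotateIndex n) (begin
    indexMap n (rotateAll r) (t + suc r) ≡⟨ cong (indexMap n (rotateAll r)) (+-suc t r) ⟩
    indexMap n (rotateAll r) (suc t + r) ≡⟨ rotateAll-shift r (suc t) (subst (_≤ n) (+-suc t r) t+r≤n) ⟩
    suc t                                ∎)
    where open ≡-Reasoning

  rotateAll-wrap : ∀ r t → t < r → r ≤ suc n → indexMap n (rotateAll r) t + r ≡ t + suc n
  rotateAll-wrap (suc r) t (s≤s t≤r) (s≤s r≤n) with m≤n⇒m<n∨m≡n t≤r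
  ... | inj₂ refl = begin
    rotateIndex n (indexMap n (rotateAll t) t) + suc t ≡⟨ cong (λ p → rotateIndex n p + suc t) (rotateAll-shift t 0 r≤n) ⟩
    n + suc t                                          ≡⟨ +-comm n (suc t) ⟩
    suc t + n                                          ≡⟨ +-suc t n ⟨
    t + suc n                                          ∎
    where open ≡-Reasoning
  ... | inj₁ t<r = trans (rotateIndex-+suc n r p>0) wrap
    where
    wrap = rotateAll-wrap r t t<r (m≤n⇒m≤1+n r≤n)
    p>0 = m+n≡o∧n<o⇒0<m wrap (≤-trans (s≤s r≤n) (m≤n+m (suc n) t))

  rotateLower-shift : ∀ b t → t + b < n → indexMap n (rotateLower b) (t + b) ≡ t
  rotateLower-shift zero    t _     = +-identityʳ t
  rotateLower-shift (suc b) t t+b<n = begin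
    opIndex n swp (rotateIndex n (indexMap n (rotateLower b) (t + suc b))) ≡⟨ cong (opIndex n swp ∘′ rotateIndex n) shift ⟩
    opIndex n swp t                                                        ≡⟨ swp-below n (≤-<-trans (s≤s (m≤m+n t b)) t+b<n′) ⟩
    t                                                                      ∎
    where
    open ≡-Reasoning
    t+b<n′ : suc t + b < n
    t+b<n′ = subst (_< n) (+-suc t b) t+b<n
    shift : indexMap n (rotateLower b) (t + suc b) ≡ suc t
    shift = trans (cong (indexMap n (rotateLower b)) (+-suc t b)) (rotateLower-shift b (suc t) t+b<n′)

  rotateLower-top : ∀ b → indexMap n (rotateLower b) n ≡ n
  rotateLower-top zero    = refl
  rotateLower-top (suc b) = trans (cong (opIndex n swp ∘′ rotateIndex n) (rotateLower-top b)) (swp-rot-top n)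

  rotateLower-wrap : ∀ b t → t < b → b ≤ n → indexMap n (rotateLower b) t + b ≡ t + n
  rotateLower-wrap (suc b) t (s≤s t≤b) b<n with m≤n⇒m<n∨m≡n t≤b
  ... | inj₂ refl = trans (cong (λ p → opIndex n swp (rotateIndex n p) + suc t) (rotateLower-shift t 0 b<n))
                          (swp-rot-zero n t (≤-<-trans z≤n b<n))
  ... | inj₁ t<b = trans (swp-rot-+suc n b p>0 p<n) wrap
    where
    wrap = rotateLower-wrap b t t<b (<⇒≤ b<n)
    p>0 = m+n≡o∧n<o⇒0<m wrap (<-≤-trans b<n (m≤n+m n t))
    p<n = +-cancelʳ-< b _ n (subst (_< n + b) (sym wrap) (subst (t + n <_) (+-comm b n) (+-monoˡ-< n t<b)))

move : ℕ → ℕ → List Op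
move n a = rotateAll (n ∸ a) ++ rotateLower a

unmove : ℕ → ℕ → List Op
unmove n a = rotateLower (n ∸ a) ++ rotateAll (suc a)

module _ {n a : ℕ} (a≤n : a ≤ n) where
  private
    r = n ∸ a
    a+r≡n : a + r ≡ n
    a+r≡n = m+[n∸m]≡n a≤n
    r≤n : r ≤ n
    r≤n = m∸n≤m n a
    t<r : ∀ {t} → t + a < n → t < r
    t<r {t} t+a<n = +-cancelʳ-< a t r (subst (t + a <_) (trans (sym a+r≡n) (+-comm a r)) t+a<n)
    j∸a+a : ∀ {j} → a ≤ j → j ∸ a + a ≡ j
    j∸a+a = m∸n+n≡m

  move-below : ∀ {j} → j < a → indexMap n (move n a) j ≡ j
  move-below {j} j<a = begin
    indexMap n (move n a) j                                  ≡⟨ indexMap-++ n (rotateAll r) (rotateLower a) j ⟩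
    indexMap n (rotateAll r) (indexMap n (rotateLower a) j)  ≡⟨ cong (indexMap n (rotateAll r)) lower ⟩
    indexMap n (rotateAll r) (j + r)                         ≡⟨ rotateAll-shift n r j (subst (j + r ≤_) a+r≡n (+-monoˡ-≤ r (<⇒≤ j<a))) ⟩
    j                                                        ∎
    where
    open ≡-Reasoning
    lower : indexMap n (rotateLower a) j ≡ j + r
    lower = +-cancelʳ-≡ a _ _ (begin
      indexMap n (rotateLower a) j + a  ≡⟨ rotateLower-wrap n a j j<a a≤n ⟩
      j + n                             ≡⟨ cong (_+_ j) a+r≡n ⟨
      j + (a + r)                       ≡⟨ cong (_+_ j) (+-comm a r) ⟩
      j + (r + a)                       ≡⟨ +-assoc j r a ⟨
      j + r + a                         ∎)

  move-above : ∀ {j} → a ≤ j → j < n → indexMap n (move n a) j ≡ suc j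
  move-above {j} a≤j j<n = begin
    indexMap n (move n a) j                                  ≡⟨ indexMap-++ n (rotateAll r) (rotateLower a) j ⟩
    indexMap n (rotateAll r) (indexMap n (rotateLower a) j)  ≡⟨ cong (indexMap n (rotateAll r)) lower ⟩
    indexMap n (rotateAll r) t                               ≡⟨ +-cancelʳ-≡ r _ _ upper ⟩
    suc j                                                    ∎
    where
    open ≡-Reasoning
    t = j ∸ a
    t+a<n : t + a < n
    t+a<n = subst (_< n) (sym (j∸a+a a≤j)) j<n
    lower : indexMap n (rotateLower a) j ≡ t
    lower = trans (cong (indexMap n (rotateLower a)) (sym (j∸a+a a≤j))) (rotateLower-shift n a t t+a<n)
    upper : indexMap n (rotateAll r) t + r ≡ suc j + r
    upper = begin
      indexMap n (rotateAll r) t + r  ≡⟨ rotateAll-wrap n r t (t<r t+a<n) (m≤n⇒m≤1+n r≤n) ⟩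
      t + suc n                       ≡⟨ cong (λ m → t + suc m) a+r≡n ⟨
      t + suc (a + r)                 ≡⟨ regroup t a r ⟩
      suc (t + a) + r                 ≡⟨ cong (λ m → suc m + r) (j∸a+a a≤j) ⟩
      suc j + r                       ∎
      where
      regroup : ∀ t a r → t + suc (a + r) ≡ suc (t + a) + r
      regroup = solve-∀

  move-top : indexMap n (move n a) n ≡ a
  move-top = begin
    indexMap n (move n a) n                                  ≡⟨ indexMap-++ n (rotateAll r) (rotateLower a) n ⟩
    indexMap n (rotateAll r) (indexMap n (rotateLower a) n)  ≡⟨ cong (indexMap n (rotateAll r)) (rotateLower-top n a) ⟩
    indexMap n (rotateAll r) n                               ≡⟨ cong (indexMap n (rotateAll r)) a+r≡n ⟨
    indexMap n (rotateAll r) (a + r)                         ≡⟨ rotateAll-shift n r a (≤-reflexive a+r≡n) ⟩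
    a                                                        ∎
    where open ≡-Reasoning

  unmove-below : ∀ {j} → j < a → indexMap n (unmove n a) j ≡ j
  unmove-below {j} j<a = begin
    indexMap n (unmove n a) j                                        ≡⟨ indexMap-++ n (rotateLower r) (rotateAll (suc a)) j ⟩
    indexMap n (rotateLower r) (indexMap n (rotateAll (suc a)) j)    ≡⟨ cong (indexMap n (rotateLower r)) lower ⟩
    indexMap n (rotateLower r) (j + r)                               ≡⟨ rotateLower-shift n r j (subst (j + r <_) a+r≡n (+-monoˡ-< r j<a)) ⟩
    j                                                                ∎
    where
    open ≡-Reasoning
    lower : indexMap n (rotateAll (suc a)) j ≡ j + r
    lower = +-cancelʳ-≡ (suc a) _ _ (begin
      indexMap n (rotateAll (suc a)) j + suc a  ≡⟨ rotateAll-wrap n (suc a) j (m≤n⇒m≤1+n j<a) (s≤s a≤n) ⟩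
      j + suc n                                 ≡⟨ cong (λ m → j + suc m) a+r≡n ⟨
      j + suc (a + r)                           ≡⟨ regroup j a r ⟩
      j + r + suc a                             ∎)
      where
      regroup : ∀ j a r → j + suc (a + r) ≡ j + r + suc a
      regroup = solve-∀

  unmove-at : indexMap n (unmove n a) a ≡ n
  unmove-at = begin
    indexMap n (unmove n a) a                                        ≡⟨ indexMap-++ n (rotateLower r) (rotateAll (suc a)) a ⟩
    indexMap n (rotateLower r) (indexMap n (rotateAll (suc a)) a)    ≡⟨ cong (indexMap n (rotateLower r)) lower ⟩
    indexMap n (rotateLower r) n                                     ≡⟨ rotateLower-top n r ⟩
    n                                                                ∎
    where
    open ≡-Reasoning
    lower : indexMap n (rotateAll (suc a)) a ≡ n
    lower = +-cancelʳ-≡ (suc a) _ _ (begin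
      indexMap n (rotateAll (suc a)) a + suc a  ≡⟨ rotateAll-wrap n (suc a) a (n<1+n a) (s≤s a≤n) ⟩
      a + suc n                                 ≡⟨ +-suc a n ⟩
      suc (a + n)                               ≡⟨ cong suc (+-comm a n) ⟩
      suc (n + a)                               ≡⟨ +-suc n a ⟨
      n + suc a                                 ∎)

  unmove-above : ∀ {j} → a ≤ j → j < n → indexMap n (unmove n a) (suc j) ≡ j
  unmove-above {j} a≤j j<n = begin
    indexMap n (unmove n a) (suc j)                                     ≡⟨ indexMap-++ n (rotateLower r) (rotateAll (suc a)) (suc j) ⟩
    indexMap n (rotateLower r) (indexMap n (rotateAll (suc a)) (suc j)) ≡⟨ cong (indexMap n (rotateLower r)) lower ⟩
    indexMap n (rotateLower r) t                                        ≡⟨ +-cancelʳ-≡ r _ _ upper ⟩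
    j                                                                   ∎
    where
    open ≡-Reasoning
    t = j ∸ a
    t+1+a≡1+j : t + suc a ≡ suc j
    t+1+a≡1+j = trans (+-suc t a) (cong suc (j∸a+a a≤j))
    t+a<n : t + a < n
    t+a<n = subst (_< n) (sym (j∸a+a a≤j)) j<n
    lower : indexMap n (rotateAll (suc a)) (suc j) ≡ t
    lower = trans (cong (indexMap n (rotateAll (suc a))) (sym t+1+a≡1+j))
                  (rotateAll-shift n (suc a) t (subst (_≤ n) (sym t+1+a≡1+j) j<n))
    upper : indexMap n (rotateLower r) t + r ≡ j + r
    upper = begin
      indexMap n (rotateLower r) t + r  ≡⟨ rotateLower-wrap n r t (t<r t+a<n) r≤n ⟩
      t + n                             ≡⟨ cong (_+_ t) a+r≡n ⟨
      t + (a + r)                       ≡⟨ +-assoc t a r ⟨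
      t + a + r                         ≡⟨ cong (_+ r) (j∸a+a a≤j) ⟩
      j + r                             ∎

  data MoveCase : ℕ → Set where
    below : ∀ {j} → j < a → MoveCase j
    above : ∀ {j} → a ≤ j → j < n → MoveCase j
    top   : MoveCase n

  moveCase : ∀ {j} → j < suc n → MoveCase j
  moveCase {j} j≤n with j <? a | j <? n
  ... | yes j<a | _       = below j<a
  ... | no  j≮a | yes j<n = above (≮⇒≥ j≮a) j<n
  ... | no  _   | no  j≮n = subst MoveCase (≤-antisym (≮⇒≥ j≮n) (≤-pred j≤n)) top

  data UnmoveCase : ℕ → Set where
    below : ∀ {j} → j < a → UnmoveCase j
    at    : UnmoveCase a
    above : ∀ {j} → a ≤ j → j < n → UnmoveCase (suc j)

  unmoveCase : ∀ {j} → j < suc n → UnmoveCase j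
  unmoveCase {j} j≤n with j <? a | j ≟ a
  ... | yes j<a | _        = below j<a
  ... | no  _   | yes refl = at
  ... | no  j≮a | no  j≢a with j
  ...   | zero  = contradiction (≤-antisym z≤n (≮⇒≥ j≮a)) j≢a
  ...   | suc i = above (≤-pred (≤∧≢⇒< (≮⇒≥ j≮a) (j≢a ∘ sym))) (≤-pred j≤n)

  move-inverses : Inverses (suc n) (indexMap n (move n a)) (indexMap n (unmove n a))
  move-inverses = record { f-< = f-< ; g-< = g-< ; f∘g = f∘g ; g∘f = g∘f }
    where
    f-< : ∀ {j} → j < suc n → indexMap n (move n a) j < suc n
    f-< j< with moveCase j<
    ... | below j<a     = subst (_< suc n) (sym (move-below j<a)) j<
    ... | above a≤j j<n = subst (_< suc n) (sym (move-above a≤j j<n)) (s≤s j<n)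
    ... | top           = subst (_< suc n) (sym move-top) (s≤s a≤n)
    g-< : ∀ {j} → j < suc n → indexMap n (unmove n a) j < suc n
    g-< j< with unmoveCase j<
    ... | below j<a     = subst (_< suc n) (sym (unmove-below j<a)) j<
    ... | at            = subst (_< suc n) (sym unmove-at) (n<1+n n)
    ... | above a≤j j<n = subst (_< suc n) (sym (unmove-above a≤j j<n)) (m<n⇒m<1+n j<n)
    f∘g : ∀ {j} → j < suc n → indexMap n (move n a) (indexMap n (unmove n a) j) ≡ j
    f∘g j< with unmoveCase j<
    ... | below j<a     = trans (cong (indexMap n (move n a)) (unmove-below j<a)) (move-below j<a)
    ... | at            = trans (cong (indexMap n (move n a)) unmove-at) move-top
    ... | above a≤j j<n = trans (cong (indexMap n (move n a)) (unmove-above a≤j j<n)) (move-above a≤j j<n)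
    g∘f : ∀ {j} → j < suc n → indexMap n (unmove n a) (indexMap n (move n a) j) ≡ j
    g∘f j< with moveCase j<
    ... | below j<a     = trans (cong (indexMap n (unmove n a)) (move-below j<a)) (unmove-below j<a)
    ... | above a≤j j<n = trans (cong (indexMap n (unmove n a)) (move-above a≤j j<n)) (unmove-above a≤j j<n)
    ... | top           = trans (cong (indexMap n (unmove n a)) move-top) unmove-at

  length-move : length (move n a) ≤ 2 * suc n
  length-move = begin
    length (move n a)                             ≡⟨ length-++ (rotateAll r) ⟩
    length (rotateAll r) + length (rotateLower a) ≡⟨ cong₂ _+_ (length-replicate r) (length-rotateLower a) ⟩
    r + a * 2                                     ≤⟨ m≤m+n (r + a * 2) (suc (suc r)) ⟩
    r + a * 2 + suc (suc r)                       ≡⟨ regroup a r ⟩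
    2 * suc (a + r)                               ≡⟨ cong (λ m → 2 * suc m) a+r≡n ⟩
    2 * suc n                                     ∎
    where
    open ≤-Reasoning
    regroup : ∀ a r → r + a * 2 + suc (suc r) ≡ 2 * suc (a + r)
    regroup = solve-∀

  length-unmove : length (unmove n a) ≤ 2 * suc n
  length-unmove = begin
    length (unmove n a)                                 ≡⟨ length-++ (rotateLower r) ⟩
    length (rotateLower r) + length (rotateAll (suc a)) ≡⟨ cong₂ _+_ (length-rotateLower r) (length-replicate (suc a)) ⟩
    r * 2 + suc a                                       ≤⟨ m≤m+n (r * 2 + suc a) (suc a) ⟩
    r * 2 + suc a + suc a                               ≡⟨ regroup a r ⟩
    2 * suc (a + r)                                     ≡⟨ cong (λ m → 2 * suc m) a+r≡n ⟩
    2 * suc n                                           ∎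
    where
    open ≤-Reasoning
    regroup : ∀ a r → r * 2 + suc a + suc a ≡ 2 * suc (a + r)
    regroup = solve-∀

member : ∀ {w} → Subset w → ℕ → Bool
member []      q       = false
member (b ∷ C) zero    = b
member (b ∷ C) (suc q) = member C q

member-lookup : ∀ {w} (C : Subset w) i → member C (toℕ i) ≡ lookup C i
member-lookup (b ∷ C) zero    = refl
member-lookup (b ∷ C) (suc i) = member-lookup C i

∈⇔member : ∀ {w} {C : Subset w} {i} → i ∈ C ⇔ member C (toℕ i) ≡ true
∈⇔member {C = C} {i} = mk⇔ (λ i∈C → trans (member-lookup C i) ([]=⇒lookup i∈C))
                           (λ eq → lookup⇒[]= i C (trans (sym (member-lookup C i)) eq))

countBelow : ∀ {w} → Subset w → ℕ → ℕ
countBelow C zero    = 0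
countBelow C (suc q) = if member C q then suc (countBelow C q) else countBelow C q

countBelow-∷ : ∀ {w} b (C : Subset w) q → countBelow (b ∷ C) (suc q) ≡ (if b then 1 else 0) + countBelow C q
countBelow-∷ true  C zero = refl
countBelow-∷ false C zero = refl
countBelow-∷ b     C (suc q) with member C q
... | true  = trans (cong suc (countBelow-∷ b C q)) (sym (+-suc _ _))
... | false = countBelow-∷ b C q

countBelow-size : ∀ {w} (C : Subset w) → countBelow C w ≡ ∣ C ∣
countBelow-size []                  = refl
countBelow-size {suc w} (true  ∷ C) = trans (countBelow-∷ true C w) (cong suc (countBelow-size C))
countBelow-size {suc w} (false ∷ C) = trans (countBelow-∷ false C w) (countBelow-size C)

module _ {n : ℕ} (C : Subset (suc n)) where

  -- Positions are moved from the highest down, so position q is still in place when it is moved.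
  gather : ℕ → List Op
  gather zero    = []
  gather (suc q) = if member C q then move n q ++ gather q else gather q

  scatter : ℕ → List Op
  scatter zero    = []
  scatter (suc q) = if member C q then scatter q ++ unmove n q else scatter q

  Processed : ℕ → Bool → ℕ → Set
  Processed q b x = x < q × member C x ≡ b

  Processed-suc : ∀ {q b x} → Processed q b x → Processed (suc q) b x
  Processed-suc (x<q , eq) = m<n⇒m<1+n x<q , eq

  Processed-subst : ∀ {q b x y} → x ≡ y → Processed q b y → Processed q b x
  Processed-subst refl = id

  record Gathered (q m : ℕ) (os : List Op) : Set where
    field
      low    : ∀ {j} → j + m < q → Processed q false (indexMap n os j)
      middle : ∀ {j} → q ≤ j + m → j + m < suc n → indexMap n os j ≡ j + m
      high   : ∀ {j} → j < suc n → suc n ≤ j + m → Processed q true (indexMap n os j)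

  gathered-zero : Gathered 0 0 []
  gathered-zero = record
    { low    = λ ()
    ; middle = λ _ _ → sym (+-identityʳ _)
    ; high   = λ {j} j<k k≤j → contradiction (subst (suc n ≤_) (+-identityʳ j) k≤j) (<⇒≱ j<k)
    }

  gathered-skip : ∀ {q m os} → q < suc n → member C q ≡ false → Gathered q m os → Gathered (suc q) m os
  gathered-skip {q} {m} {os} q<k q∉C G = record
    { low    = low′
    ; middle = middle ∘ <⇒≤
    ; high   = λ j<k k≤j+m → Processed-suc (high j<k k≤j+m)
    }
    where
    open Gathered G
    low′ : ∀ {j} → j + m < suc q → Processed (suc q) false (indexMap n os j)
    low′ (s≤s j+m≤q) with m≤n⇒m<n∨m≡n j+m≤q
    ... | inj₁ j+m<q = Processed-suc (low j+m<q)
    ... | inj₂ refl  = Processed-subst (middle ≤-refl q<k) (n<1+n q , q∉C)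

  gathered-move : ∀ {q m os} → q < suc n → member C q ≡ true → Gathered q m os →
                  Gathered (suc q) (suc m) (move n q ++ os)
  gathered-move {q} {m} {os} (s≤s q≤n) q∈C G = record
    { low    = λ j+m<q → kept (low (m+1+n<1+o⇒m+n<o j+m<q))
    ; middle = middle′
    ; high   = high′
    }
    where
    open Gathered G
    P′≡M∘P : ∀ j → indexMap n (move n q ++ os) j ≡ indexMap n (move n q) (indexMap n os j)
    P′≡M∘P = indexMap-++ n (move n q) os
    kept : ∀ {j b} → Processed q b (indexMap n os j) →
           Processed (suc q) b (indexMap n (move n q ++ os) j)
    kept {j} P = Processed-subst (trans (P′≡M∘P j) (move-below q≤n (proj₁ P))) (Processed-suc P)
    middle′ : ∀ {j} → suc q ≤ j + suc m → j + suc m < suc n → indexMap n (move n q ++ os) j ≡ j + suc m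
    middle′ {j} q<j+m j+m<n = begin
      indexMap n (move n q ++ os) j           ≡⟨ P′≡M∘P j ⟩
      indexMap n (move n q) (indexMap n os j) ≡⟨ cong (indexMap n (move n q)) (middle q≤j+m (m<n⇒m<1+n j+m<n′)) ⟩
      indexMap n (move n q) (j + m)           ≡⟨ move-above q≤n q≤j+m j+m<n′ ⟩
      suc (j + m)                             ≡⟨ +-suc j m ⟨
      j + suc m                               ∎
      where
      open ≡-Reasoning
      q≤j+m = 1+o≤m+1+n⇒o≤m+n q<j+m
      j+m<n′ = m+1+n<1+o⇒m+n<o j+m<n
    high′ : ∀ {j} → j < suc n → suc n ≤ j + suc m →
            Processed (suc q) true (indexMap n (move n q ++ os) j)
    high′ {j} j<k k≤j+m with m≤n⇒m<n∨m≡n (1+o≤m+1+n⇒o≤m+n k≤j+m)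
    ... | inj₁ n<j+m = kept (high j<k n<j+m)
    ... | inj₂ n≡j+m = Processed-subst P′j≡q (n<1+n q , q∈C)
      where
      P′j≡q : indexMap n (move n q ++ os) j ≡ q
      P′j≡q = begin
        indexMap n (move n q ++ os) j           ≡⟨ P′≡M∘P j ⟩
        indexMap n (move n q) (indexMap n os j) ≡⟨ cong (indexMap n (move n q)) Pj≡n ⟩
        indexMap n (move n q) n                 ≡⟨ move-top q≤n ⟩
        q                                       ∎
        where
        open ≡-Reasoning
        Pj≡n : indexMap n os j ≡ n
        Pj≡n = trans (middle (subst (q ≤_) n≡j+m q≤n) (subst (_< suc n) n≡j+m (n<1+n n))) (sym n≡j+m)

  gather-gathered : ∀ q → q ≤ suc n → Gathered q (countBelow C q) (gather q)
  gather-gathered zero    _   = gathered-zero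
  gather-gathered (suc q) q<k with member C q in q∈?C
  ... | true  = gathered-move q<k q∈?C (gather-gathered q (<⇒≤ q<k))
  ... | false = gathered-skip q<k q∈?C (gather-gathered q (<⇒≤ q<k))

  gather-inverses : ∀ q → q ≤ suc n → Inverses (suc n) (indexMap n (gather q)) (indexMap n (scatter q))
  gather-inverses zero    _         = Inverses-id
  gather-inverses (suc q) (s≤s q≤n) with member C q
  ... | true  = indexMap-inverses-++ n (move n q) (unmove n q) (gather q) (scatter q)
                  (move-inverses q≤n) (gather-inverses q (m≤n⇒m≤1+n q≤n))
  ... | false = gather-inverses q (m≤n⇒m≤1+n q≤n)

  length-gather : ∀ q → q ≤ suc n → length (gather q) ≤ countBelow C q * (2 * suc n)
  length-gather zero    _         = z≤n
  length-gather (suc q) (s≤s q≤n) with member C q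
  ... | true  = ≤-trans (≤-reflexive (length-++ (move n q)))
                        (+-mono-≤ (length-move q≤n) (length-gather q (m≤n⇒m≤1+n q≤n)))
  ... | false = length-gather q (m≤n⇒m≤1+n q≤n)

  length-scatter : ∀ q → q ≤ suc n → length (scatter q) ≤ countBelow C q * (2 * suc n)
  length-scatter zero    _         = z≤n
  length-scatter (suc q) (s≤s q≤n) with member C q
  ... | true  = ≤-trans (≤-reflexive (trans (length-++ (scatter q)) (+-comm _ (length (unmove n q)))))
                        (+-mono-≤ (length-unmove q≤n) (length-scatter q (m≤n⇒m≤1+n q≤n)))
  ... | false = length-scatter q (m≤n⇒m≤1+n q≤n)

  private
    k = suc n
    P  = indexMap n (gather k)
    P′ = indexMap n (scatter k)
    inverses = gather-inverses k ≤-refl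
    open Inverses inverses
    gathered : Gathered k ∣ C ∣ (gather k)
    gathered = subst (λ m → Gathered k m (gather k)) (countBelow-size C) (gather-gathered k ≤-refl)
    open Gathered gathered

  gatheringPermutation : Permutation′ k
  gatheringPermutation = toPermutation inverses

  gathered-member⇔ : ∀ {j} → j < k → member C (P j) ≡ true ⇔ k ≤ j + ∣ C ∣
  gathered-member⇔ {j} j<k = mk⇔ marked (proj₂ ∘ high j<k)
    where
    marked : member C (P j) ≡ true → k ≤ j + ∣ C ∣
    marked P∈C with k ≤? j + ∣ C ∣
    ... | yes k≤j+m = k≤j+m
    ... | no  k≰j+m with () ← trans (sym P∈C) (proj₂ (low (≰⇒> k≰j+m)))

  gatheringPermutation-gathers : ∀ i → i ∈ C ⇔ (k ∸ ∣ C ∣ ≤ toℕ (gatheringPermutation ⟨$⟩ʳ i))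
  gatheringPermutation-gathers i = begin
    i ∈ C                              ≈⟨ ∈⇔member ⟩
    member C (toℕ i) ≡ true            ≡⟨ cong (λ x → member C x ≡ true) (f∘g (toℕ<n i)) ⟨
    member C (P (P′ (toℕ i))) ≡ true   ≈⟨ gathered-member⇔ (g-< (toℕ<n i)) ⟩
    k ≤ P′ (toℕ i) + ∣ C ∣             ≈⟨ ≤+⇔∸≤ ⟩
    k ∸ ∣ C ∣ ≤ P′ (toℕ i)             ≡⟨ cong (k ∸ ∣ C ∣ ≤_) (toPermutation-ʳ inverses i) ⟨
    k ∸ ∣ C ∣ ≤ toℕ (gatheringPermutation ⟨$⟩ʳ i) ∎
    where open ≈-Reasoning (⇔-setoid 0ℓ)

  gatherPL scatterPL : List (PLBij (+ 0) (+ (2 ^ k)))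
  gatherPL  = map (opPL n) (gather k)
  scatterPL = map (opPL n) (scatter k)

  private
    bitPerm≡ : ∀ x → bitPerm k gatheringPermutation x ≡ fromBits k (bit x ∘ P)
    bitPerm≡ = bitPerm-fromBits k gatheringPermutation P (toPermutation-ˡ inverses)

  gatherPL-bitPerm : ∀ {x} → x < 2 ^ k → compose gatherPL (+ x) ≡ + bitPerm k gatheringPermutation x
  gatherPL-bitPerm {x} x< = begin
    compose gatherPL (+ x)                       ≡⟨ cong (compose gatherPL ∘ +_) (fromBits-bit k x<) ⟨
    compose gatherPL (+ fromBits k (bit x))      ≡⟨ compose-opPL n (gather k) (bits-bit x) ⟩
    + fromBits k (bit x ∘ P)                     ≡⟨ cong +_ (bitPerm≡ x) ⟨
    + bitPerm k gatheringPermutation x           ∎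
    where open ≡-Reasoning

  scatterPL-bitPerm : ∀ {x} → x < 2 ^ k → compose scatterPL (+ bitPerm k gatheringPermutation x) ≡ + x
  scatterPL-bitPerm {x} x< = begin
    compose scatterPL (+ bitPerm k gatheringPermutation x) ≡⟨ cong (compose scatterPL ∘ +_) (bitPerm≡ x) ⟩
    compose scatterPL (+ fromBits k (bit x ∘ P))           ≡⟨ compose-opPL n (scatter k) (bits-bit x ∘ P) ⟩
    + fromBits k (bit x ∘ P ∘ P′)                          ≡⟨ cong +_ (fromBits-cong k (cong (bit x) ∘ f∘g)) ⟩
    + fromBits k (bit x)                                   ≡⟨ cong +_ (fromBits-bit k x<) ⟩
    + x                                                    ∎
    where open ≡-Reasoning

  private
    length-map-opPL : ∀ os → length os ≤ countBelow C k * (2 * k) → length (map (opPL n) os) ≤ 2 * (∣ C ∣ * k)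
    length-map-opPL os = subst₂ _≤_ (sym (length-map (opPL n) os))
                                    (trans (cong (_* (2 * k)) (countBelow-size C)) (regroup ∣ C ∣ k))
      where
      regroup : ∀ m k → m * (2 * k) ≡ 2 * (m * k)
      regroup = solve-∀

  length-gatherPL : length gatherPL ≤ 2 * (∣ C ∣ * k)
  length-gatherPL = length-map-opPL (gather k) (length-gather k ≤-refl)

  length-scatterPL : length scatterPL ≤ 2 * (∣ C ∣ * k)
  length-scatterPL = length-map-opPL (scatter k) (length-scatter k ≤-refl)

  gatherPL-pieces : All (λ g → PLBij.pieces g ≤ 4) gatherPL
  gatherPL-pieces = All-opPL-pieces n (gather k)

  scatterPL-pieces : All (λ g → PLBij.pieces g ≤ 4) scatterPL
  scatterPL-pieces = All-opPL-pieces n (scatter k)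

lemma25 : Σ ℕ λ c₁ → Σ ℕ λ c₂ →
    (k : ℕ) → 1 ≤ k → (C : Subset k) →
    Σ (Permutation′ k) λ σ →
      ((i : Fin k) → (i ∈ C) ⇔ (k ∸ ∣ C ∣ ≤ toℕ (σ ⟨$⟩ʳ i))) ×
      (Σ (List (PLBij (+ 0) (+ (2 ^ k)))) λ gs →
        (length gs ≤ c₁ * (∣ C ∣ * k)) ×
        All (λ g → PLBij.pieces g ≤ c₂) gs ×
        ((x : ℕ) → x < 2 ^ k → compose gs (+ x) ≡ + bitPerm k σ x)) ×
      (Σ (List (PLBij (+ 0) (+ (2 ^ k)))) λ hs →
        (length hs ≤ c₁ * (∣ C ∣ * k)) ×
        All (λ h → PLBij.pieces h ≤ c₂) hs ×
        ((x : ℕ) → x < 2 ^ k → compose hs (+ bitPerm k σ x) ≡ + x))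
lemma25 = 2 , 4 , λ where
  (suc n) _ C →
    gatheringPermutation C , gatheringPermutation-gathers C ,
    (gatherPL C  , length-gatherPL C  , gatherPL-pieces C , λ _ → gatherPL-bitPerm C) ,
    (scatterPL C , length-scatterPL C , scatterPL-pieces C , λ _ → scatterPL-bitPerm C)
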